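{- For every $n\ge 1$, the diameter of the Cayley graph $H_n$ is at most $(n-1)2^n+1$.
   Context: Let $S_{2^n}$ be the symmetric group on $\{0,1,\dots,2^n-1\}$. For $v$ in this set and $j\in\{0,\dots,n-1\}$, $v\oplus 2^j$ is $v$ with bit $j$ of its binary expansion flipped. Let $C_H=\{(v\ \ v\oplus 2^j): v\in\{0,\dots,2^n-1\},\ j\in\{0,\dots,n-1\}\}$ (the permutations realized by a single multiple-control Toffoli gate whose $n-1$ non-target lines are all positive or negative controls). The Cayley graph $H_n$ has vertex set $S_{2^n}$, with $g,h$ adjacent iff $h=c\circ g$ for some $c\in C_H$. The diameter is the largest shortest-path distance between two vertices. -}

module Defs where

open import Data.Nat using (ℕ; zero; suc; _+_; _*_; _^_; _≤_; _∸_; _/_; _%_; _≟_)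
open import Data.Nat.Properties using (+-identityʳ)
open import Data.Fin renaming (zero to Fz; suc to Fs) using (Fin; toℕ; splitAt; _↑ˡ_; _↑ʳ_; cast; lower₁)
open import Data.Fin.Permutation using (Permutation′; transpose; _∘ₚ_; _≈_)
open import Data.Sum using (inj₁; inj₂)
open import Data.Product using (∃-syntax; _×_)
open import Data.Bool using (if_then_else_)
open import Relation.Nullary using (yes; no)
open import Relation.Binary.PropositionalEquality using (_≡_; refl)

-- Vertices of the hypercube: Fin (2 ^ n) = {0, …, 2^n - 1}.
-- Note 2 ^ suc n reduces to 2 ^ n + (2 ^ n + 0): the lower half is bit n = 0,
-- the upper half is bit n = 1.

-- flipBit n j v : the element v ⊕ 2^j (bit j of v flipped), j < n.
flipBit : (n : ℕ) → Fin n → Fin (2 ^ n) → Fin (2 ^ n)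
flipBit (suc n) j v with splitAt (2 ^ n) v | n ≟ toℕ j
... | inj₁ x | yes _  = (2 ^ n) ↑ʳ (x ↑ˡ 0)
... | inj₂ y | yes _  = cast (+-identityʳ (2 ^ n)) y ↑ˡ (2 ^ n + 0)
... | inj₁ x | no n≢j = flipBit n (lower₁ j n≢j) x ↑ˡ (2 ^ n + 0)
... | inj₂ y | no n≢j = (2 ^ n) ↑ʳ (flipBit n (lower₁ j n≢j) (cast (+-identityʳ (2 ^ n)) y) ↑ˡ 0)

private
  ex0 : toℕ (flipBit 3 (Fz) (Fs (Fs (Fs (Fs (Fs Fz)))))) ≡ 4
  ex0 = refl
  ex1 : toℕ (flipBit 3 (Fs Fz) (Fs (Fs (Fs (Fs (Fs Fz)))))) ≡ 7
  ex1 = refl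
  ex2 : toℕ (flipBit 3 (Fs (Fs Fz)) (Fs (Fs (Fs (Fs (Fs Fz)))))) ≡ 1
  ex2 = refl

gen : (n : ℕ) → Fin (2 ^ n) → Fin n → Permutation′ (2 ^ n)
gen n v j = transpose v (flipBit n j v)

-- Walk n g h k : a walk of length k from g to h in the Cayley graph H_n,
-- where each edge goes from g to c ∘ g with c ∈ C_H.
-- (g ∘ₚ c applies g first, then c, i.e. it is c ∘ g.)
-- Vertices (permutations) are compared extensionally (_≈_ from the library).
data Walk (n : ℕ) : Permutation′ (2 ^ n) → Permutation′ (2 ^ n) → ℕ → Set where
  done : ∀ {g h} → g ≈ h → Walk n g h 0
  step : ∀ {g h k} (v : Fin (2 ^ n)) (j : Fin n) →
         Walk n (g ∘ₚ gen n v j) h k → Walk n g h (suc k)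

DistAtMost : (n : ℕ) → Permutation′ (2 ^ n) → Permutation′ (2 ^ n) → ℕ → Set
DistAtMost n g h d = ∃[ k ] (k ≤ d × Walk n g h k)

DiameterAtMost : ℕ → ℕ → Set
DiameterAtMost n d = ∀ (g h : Permutation′ (2 ^ n)) → DistAtMost n g h d

module Submission where

-- Fix a target permutation h. A permutation f is "placed from t" when it agrees
-- with h at every position where h takes a value ≥ t; every g is placed from 2ⁿ
-- and being placed from 0 means f ≈ h. We place the values q = 2ⁿ-1, …, 1, 0 one
-- at a time. When the values ≥ q+1 are placed, the position i with h(i) = q holds
-- a value a ≤ q (bijectivity), and there is a hypercube path from a to q of length
-- ≤ k through vertices ≤ q whenever q < 2ᵏ (the monotone path lemma). Carrying
-- the token along this path uses one generator (v  v⊕2ʲ) per edge and only ever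
-- swaps values ≤ q, so the values already placed stay put. A value in
-- [2ᵏ, 2ᵏ⁺¹) thus costs k+1 steps, and Σ_{k<n} 2ᵏ(k+1) = (n-1)·2ⁿ + 1.

open import Defs
open import Data.Nat using (ℕ; _≥_; _∸_; _*_; _^_; _+_)
open import Data.Nat using (zero; suc; _≤_; _<_; _≟_; _<?_; z≤n; s≤s; s≤s⁻¹)
open import Data.Nat.Properties
open import Data.Nat.Solver using (module +-*-Solver)
open import Data.Fin using (Fin; toℕ; _↑ˡ_; _↑ʳ_; splitAt; cast; inject₁; fromℕ; fromℕ<)
  renaming (zero to fzero)
open import Data.Fin.Properties
  using (toℕ-↑ˡ; toℕ-↑ʳ; toℕ-cast; toℕ-injective; splitAt-↑ˡ; splitAt-↑ʳ; splitAt⁻¹-↑ˡ;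
         splitAt⁻¹-↑ʳ; toℕ-inject₁; toℕ-fromℕ; toℕ<n; lower₁-inject₁′; toℕ-fromℕ<)
  renaming (_≟_ to _≟ᶠ_)
open import Data.Fin.Permutation using (Permutation′; _⟨$⟩ʳ_; _⟨$⟩ˡ_; inverseʳ; _∘ₚ_; _≈_)
import Data.Fin.Permutation.Components as Components
open import Function.Bundles using (Injection)
open import Function.Properties.Inverse using (Inverse⇒Injection)
open import Data.Sum using (inj₁; inj₂)
open import Data.Product using (∃-syntax; _×_; _,_)
open import Data.Unit using (⊤; tt)
open import Data.Empty using (⊥-elim)
open import Relation.Nullary using (yes; no)
open import Relation.Binary.PropositionalEquality

lower : ∀ n → Fin (2 ^ n) → Fin (2 ^ suc n)
lower n x = x ↑ˡ (2 ^ n + 0)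

upper : ∀ n → Fin (2 ^ n) → Fin (2 ^ suc n)
upper n y = (2 ^ n) ↑ʳ (y ↑ˡ 0)

toℕ-lower : ∀ n x → toℕ (lower n x) ≡ toℕ x
toℕ-lower n x = toℕ-↑ˡ x (2 ^ n + 0)

toℕ-upper : ∀ n y → toℕ (upper n y) ≡ 2 ^ n + toℕ y
toℕ-upper n y = trans (toℕ-↑ʳ (2 ^ n) (y ↑ˡ 0)) (cong (2 ^ n +_) (toℕ-↑ˡ y 0))

lower-small : ∀ n x → toℕ (lower n x) < 2 ^ n
lower-small n x = subst (_< 2 ^ n) (sym (toℕ-lower n x)) (toℕ<n x)

upper-large : ∀ n y → 2 ^ n ≤ toℕ (upper n y)
upper-large n y = subst (2 ^ n ≤_) (sym (toℕ-upper n y)) (m≤m+n (2 ^ n) (toℕ y))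

cast-pad : ∀ {m} .(e : m + 0 ≡ m) (y : Fin m) → cast e (y ↑ˡ 0) ≡ y
cast-pad e y = toℕ-injective (trans (toℕ-cast e (y ↑ˡ 0)) (toℕ-↑ˡ y 0))

pad-cast : ∀ {m} .(e : m + 0 ≡ m) (w : Fin (m + 0)) → cast e w ↑ˡ 0 ≡ w
pad-cast e w = toℕ-injective (trans (toℕ-↑ˡ (cast e w) 0) (toℕ-cast e w))

data Half (n : ℕ) : Fin (2 ^ suc n) → Set where
  low  : ∀ x → Half n (lower n x)
  high : ∀ y → Half n (upper n y)

half : ∀ n v → Half n v
half n v with splitAt (2 ^ n) v in eq
... | inj₁ x = subst (Half n) (splitAt⁻¹-↑ˡ eq) (low x)
... | inj₂ w = subst (Half n) (trans (cong (2 ^ n ↑ʳ_) (pad-cast (+-identityʳ (2 ^ n)) w))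
                                     (splitAt⁻¹-↑ʳ eq))
                             (high (cast (+-identityʳ (2 ^ n)) w))

top≢inject₁ : ∀ {n} (j : Fin n) → n ≢ toℕ (inject₁ j)
top≢inject₁ {n} j e = <⇒≢ (subst (_< n) (sym (toℕ-inject₁ j)) (toℕ<n j)) (sym e)

flip-lower : ∀ n (j : Fin n) x →
             flipBit (suc n) (inject₁ j) (lower n x) ≡ lower n (flipBit n j x)
flip-lower n j x rewrite splitAt-↑ˡ (2 ^ n) x (2 ^ n + 0) with n ≟ toℕ (inject₁ j)
... | yes e = ⊥-elim (top≢inject₁ j e)
... | no ne = cong (λ t → lower n (flipBit n t x)) (lower₁-inject₁′ j ne)

flip-upper : ∀ n (j : Fin n) y →
             flipBit (suc n) (inject₁ j) (upper n y) ≡ upper n (flipBit n j y)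
flip-upper n j y rewrite splitAt-↑ʳ (2 ^ n) (2 ^ n + 0) (y ↑ˡ 0) with n ≟ toℕ (inject₁ j)
... | yes e = ⊥-elim (top≢inject₁ j e)
... | no ne = cong₂ (λ t u → upper n (flipBit n t u))
                    (lower₁-inject₁′ j ne) (cast-pad (+-identityʳ (2 ^ n)) y)

flip-top-lower : ∀ n x → flipBit (suc n) (fromℕ n) (lower n x) ≡ upper n x
flip-top-lower n x rewrite splitAt-↑ˡ (2 ^ n) x (2 ^ n + 0) with n ≟ toℕ (fromℕ n)
... | yes _ = refl
... | no ne = ⊥-elim (ne (sym (toℕ-fromℕ n)))

flip-top-upper : ∀ n y → flipBit (suc n) (fromℕ n) (upper n y) ≡ lower n y
flip-top-upper n y rewrite splitAt-↑ʳ (2 ^ n) (2 ^ n + 0) (y ↑ˡ 0) with n ≟ toℕ (fromℕ n)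
... | yes _ = cong (lower n) (cast-pad (+-identityʳ (2 ^ n)) y)
... | no ne = ⊥-elim (ne (sym (toℕ-fromℕ n)))

data Path (n : ℕ) (P : Fin (2 ^ n) → Set) : Fin (2 ^ n) → Fin (2 ^ n) → ℕ → Set where
  nil  : ∀ {a} → Path n P a a 0
  cons : ∀ {a b k} (j : Fin n) → P (flipBit n j a) → Path n P (flipBit n j a) b k →
         Path n P a b (suc k)

consVia : ∀ {n P a b c k} (j : Fin n) → flipBit n j a ≡ c → P c → Path n P c b k →
          Path n P a b (suc k)
consVia j refl p r = cons j p r

snocVia : ∀ {n P a b c k} → Path n P a b k → (j : Fin n) → flipBit n j b ≡ c → P c →
          Path n P a c (suc k)
snocVia nil          j e p = consVia j e p nil
snocVia (cons i q r) j e p = cons i q (snocVia r j e p)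

liftLower : ∀ {n P Q a b k} → (∀ x → P x → Q (lower n x)) →
            Path n P a b k → Path (suc n) Q (lower n a) (lower n b) k
liftLower t nil = nil
liftLower {n} t (cons {a} j p r) = consVia (inject₁ j) (flip-lower n j a) (t _ p) (liftLower t r)

liftUpper : ∀ {n P Q a b k} → (∀ y → P y → Q (upper n y)) →
            Path n P a b k → Path (suc n) Q (upper n a) (upper n b) k
liftUpper t nil = nil
liftUpper {n} t (cons {a} j p r) = consVia (inject₁ j) (flip-upper n j a) (t _ p) (liftUpper t r)

hypercube-path : ∀ N (a b : Fin (2 ^ N)) → ∃[ k ] (k ≤ N × Path N (λ _ → ⊤) a b k)
hypercube-path zero fzero fzero = 0 , z≤n , nil
hypercube-path (suc n) a b with half n a | half n b
... | low x  | low y  = let k , k≤n , p = hypercube-path n x y in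
  k , m≤n⇒m≤1+n k≤n , liftLower (λ _ _ → tt) p
... | low x  | high y = let k , k≤n , p = hypercube-path n x y in
  suc k , s≤s k≤n , consVia (fromℕ n) (flip-top-lower n x) tt (liftUpper (λ _ _ → tt) p)
... | high x | low y  = let k , k≤n , p = hypercube-path n x y in
  suc k , s≤s k≤n , consVia (fromℕ n) (flip-top-upper n x) tt (liftLower (λ _ _ → tt) p)
... | high x | high y = let k , k≤n , p = hypercube-path n x y in
  k , m≤n⇒m≤1+n k≤n , liftUpper (λ _ _ → tt) p

^-cancelʳ-< : ∀ m k → 2 ^ m < 2 ^ k → m < k
^-cancelʳ-< m k lt with m <? k
... | yes m<k = m<k
... | no m≮k  = ⊥-elim (<⇒≱ lt (^-monoʳ-≤ 2 (≮⇒≥ m≮k)))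

upper-exponent : ∀ n y k → toℕ (upper n y) < 2 ^ k → n < k
upper-exponent n y k lt = ^-cancelʳ-< n k (≤-<-trans (upper-large n y) lt)

-- Monotone path lemma: if a ≤ b < 2ᵏ then a and b are joined by a path of
-- length ≤ k through vertices ≤ b.  (Only the low k bits of a and b differ; fix
-- the low bits first and raise the high bits last.)
monotone-path : ∀ N (a b : Fin (2 ^ N)) k → toℕ b < 2 ^ k → toℕ a ≤ toℕ b →
                ∃[ len ] (len ≤ k × Path N (λ v → toℕ v ≤ toℕ b) a b len)
monotone-path zero fzero fzero k _ _ = 0 , z≤n , nil
monotone-path (suc n) a b k b<2ᵏ a≤b with half n a | half n b
... | low x  | low y  =
  let y<2ᵏ = subst (_< 2 ^ k) (toℕ-lower n y) b<2ᵏ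
      x≤y = subst₂ _≤_ (toℕ-lower n x) (toℕ-lower n y) a≤b
      len , len≤k , p = monotone-path n x y k y<2ᵏ x≤y
  in len , len≤k ,
     liftLower (λ v v≤y → subst₂ _≤_ (sym (toℕ-lower n v)) (sym (toℕ-lower n y)) v≤y) p
... | low x  | high y =
  let len , len≤n , p = hypercube-path n x y in
  suc len , ≤-trans (s≤s len≤n) (upper-exponent n y k b<2ᵏ) ,
  snocVia (liftLower (λ v _ → <⇒≤ (<-≤-trans (lower-small n v) (upper-large n y))) p)
          (fromℕ n) (flip-top-lower n y) ≤-refl
... | high x | low y  = ⊥-elim (<⇒≱ (lower-small n y) (≤-trans (upper-large n x) a≤b))
... | high x | high y =
  let x≤y = +-cancelˡ-≤ (2 ^ n) _ _ (subst₂ _≤_ (toℕ-upper n x) (toℕ-upper n y) a≤b)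
      len , len≤n , p = monotone-path n x y n (toℕ<n y) x≤y
  in len , ≤-trans len≤n (<⇒≤ (upper-exponent n y k b<2ᵏ)) ,
     liftUpper (λ v v≤y → subst₂ _≤_ (sym (toℕ-upper n v)) (sym (toℕ-upper n y))
                                     (+-monoʳ-≤ (2 ^ n) v≤y)) p

perm-injective : ∀ {m} (π : Permutation′ m) {i j : Fin m} → π ⟨$⟩ʳ i ≡ π ⟨$⟩ʳ j → i ≡ j
perm-injective π = Injection.injective (Inverse⇒Injection π)

walk-≈ˡ : ∀ {n f g h k} → f ≈ g → Walk n g h k → Walk n f h k
walk-≈ˡ f≈g (done g≈h)   = done (λ i → trans (f≈g i) (g≈h i))
walk-≈ˡ f≈g (step v j w) = step v j (walk-≈ˡ (λ i → cong (gen _ v j ⟨$⟩ʳ_) (f≈g i)) w)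

walk-≈ʳ : ∀ {n f g h k} → Walk n f g k → g ≈ h → Walk n f h k
walk-≈ʳ (done f≈g)   g≈h = done (λ i → trans (f≈g i) (g≈h i))
walk-≈ʳ (step v j w) g≈h = step v j (walk-≈ʳ w g≈h)

_++ʷ_ : ∀ {n f g h a b} → Walk n f g a → Walk n g h b → Walk n f h (a + b)
done f≈g   ++ʷ w = walk-≈ˡ f≈g w
step v j w ++ʷ w′ = step v j (w ++ʷ w′)

dist-trans : ∀ {n f g h a b} → DistAtMost n f g a → DistAtMost n g h b →
             DistAtMost n f h (a + b)
dist-trans (k , k≤a , w) (l , l≤b , w′) = k + l , +-mono-≤ k≤a l≤b , w ++ʷ w′

transpose-hit : ∀ {m} (a b : Fin m) → Components.transpose a b a ≡ b
transpose-hit a b with a ≟ᶠ a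
... | yes _ = refl
... | no a≢a = ⊥-elim (a≢a refl)

transpose-miss : ∀ {m} (a b c : Fin m) → c ≢ a → c ≢ b → Components.transpose a b c ≡ c
transpose-miss a b c c≢a c≢b with c ≟ᶠ a
... | yes c≡a = ⊥-elim (c≢a c≡a)
... | no _ with c ≟ᶠ b
...   | yes c≡b = ⊥-elim (c≢b c≡b)
...   | no _ = refl

above≢ : ∀ {m q} {v w : Fin m} → q < toℕ w → toℕ v ≤ q → w ≢ v
above≢ q<w v≤q w≡v = <⇒≱ q<w (subst (λ z → toℕ z ≤ _) (sym w≡v) v≤q)

module Carrying (n : ℕ) where

  KeepsAbove : ℕ → Permutation′ (2 ^ n) → Permutation′ (2 ^ n) → Set
  KeepsAbove q f f′ = ∀ i → q < toℕ (f ⟨$⟩ʳ i) → f′ ⟨$⟩ʳ i ≡ f ⟨$⟩ʳ i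

  keeps-trans : ∀ {q} (f g h : Permutation′ (2 ^ n)) →
                KeepsAbove q f g → KeepsAbove q g h → KeepsAbove q f h
  keeps-trans {q} f g h f→g g→h i q<fi =
    trans (g→h i (subst (λ z → q < toℕ z) (sym (f→g i q<fi)) q<fi)) (f→g i q<fi)

  gen-keeps : ∀ {q} (f : Permutation′ (2 ^ n)) v j → toℕ v ≤ q → toℕ (flipBit n j v) ≤ q →
              KeepsAbove q f (f ∘ₚ gen n v j)
  gen-keeps f v j v≤q v′≤q i q<fi = transpose-miss _ _ _ (above≢ q<fi v≤q) (above≢ q<fi v′≤q)

  carry : ∀ {q a b k} → Path n (λ v → toℕ v ≤ q) a b k → toℕ a ≤ q →
          ∀ (f : Permutation′ (2 ^ n)) i → f ⟨$⟩ʳ i ≡ a →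
          ∃[ f′ ] (f′ ⟨$⟩ʳ i ≡ b × KeepsAbove q f f′ × Walk n f f′ k)
  carry nil _ f i fi≡a = f , fi≡a , (λ _ _ → refl) , done (λ _ → refl)
  carry (cons {a} j a′≤q r) a≤q f i fi≡a =
    let f′ , f′i≡b , keeps , w = carry r a′≤q (f ∘ₚ gen n a j) i moved
    in f′ , f′i≡b , keeps-trans f (f ∘ₚ gen n a j) f′ (gen-keeps f a j a≤q a′≤q) keeps ,
       step a j w
    where
    moved : (f ∘ₚ gen n a j) ⟨$⟩ʳ i ≡ flipBit n j a
    moved = trans (cong (gen n a j ⟨$⟩ʳ_) fi≡a) (transpose-hit a (flipBit n j a))

-- cost m = Σ_{k<m} 2ᵏ(k+1): the values in [2ᵏ, 2ᵏ⁺¹) cost k+1 steps each.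
cost : ℕ → ℕ
cost zero    = 0
cost (suc m) = 2 ^ m * suc m + cost m

cost-closed : ∀ m → cost (suc m) ≡ m * 2 ^ suc m + 1
cost-closed zero    = refl
cost-closed (suc m) = begin
  X * suc (suc m) + cost (suc m)  ≡⟨ cong (X * suc (suc m) +_) (cost-closed m) ⟩
  X * suc (suc m) + (m * X + 1)   ≡⟨ solve 2 (λ X m → X :* (con 2 :+ m) :+ (m :* X :+ con 1)
                                                     := (con 1 :+ m) :* (con 2 :* X) :+ con 1)
                                             refl X m ⟩
  suc m * 2 ^ suc (suc m) + 1     ∎
  where
  open ≡-Reasoning
  open +-*-Solver using (solve; _:=_; _:+_; _:*_; con)
  X = 2 ^ suc m

module Placement (n : ℕ) (h : Permutation′ (2 ^ n)) where

  open Carrying n using (KeepsAbove; carry)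

  PlacedFrom : ℕ → Permutation′ (2 ^ n) → Set
  PlacedFrom t f = ∀ i → t ≤ toℕ (h ⟨$⟩ʳ i) → f ⟨$⟩ʳ i ≡ h ⟨$⟩ʳ i

  Reaches : ℕ → ℕ → Permutation′ (2 ^ n) → Set
  Reaches t d f = ∃[ f′ ] (PlacedFrom t f′ × DistAtMost n f f′ d)

  reaches-here : ∀ {t f} → PlacedFrom t f → Reaches t 0 f
  reaches-here {f = f} placed = f , placed , 0 , z≤n , done (λ _ → refl)

  reaches-then : ∀ {t s a b f} → Reaches t a f → (∀ f′ → PlacedFrom t f′ → Reaches s b f′) →
                 Reaches s (a + b) f
  reaches-then (f′ , placed , d) next =
    let f″ , placed′ , d′ = next f′ placed in f″ , placed′ , dist-trans d d′

  -- Once the values ≥ t are placed, a position whose target is < t holds a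
  -- value < t: the values ≥ t are all taken by their own positions.
  placed-small : ∀ {t f} → PlacedFrom t f → ∀ i → toℕ (h ⟨$⟩ʳ i) < t → toℕ (f ⟨$⟩ʳ i) < t
  placed-small {t} {f} placed i hi<t with toℕ (f ⟨$⟩ʳ i) <? t
  ... | yes fi<t = fi<t
  ... | no fi≮t  = ⊥-elim (<⇒≱ hi<t (subst (λ x → t ≤ toℕ (h ⟨$⟩ʳ x)) j≡i t≤hj))
    where
    j = h ⟨$⟩ˡ (f ⟨$⟩ʳ i)
    t≤hj : t ≤ toℕ (h ⟨$⟩ʳ j)
    t≤hj = subst (λ v → t ≤ toℕ v) (sym (inverseʳ h)) (≮⇒≥ fi≮t)
    j≡i : j ≡ i
    j≡i = perm-injective f (trans (placed j t≤hj) (inverseʳ h))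

  placed-step : ∀ {f f′} i → f′ ⟨$⟩ʳ i ≡ h ⟨$⟩ʳ i →
                PlacedFrom (suc (toℕ (h ⟨$⟩ʳ i))) f → KeepsAbove (toℕ (h ⟨$⟩ʳ i)) f f′ →
                PlacedFrom (toℕ (h ⟨$⟩ʳ i)) f′
  placed-step {f} {f′} i f′i≡hi placed keeps i′ q≤hi′ with m≤n⇒m<n∨m≡n q≤hi′
  ... | inj₁ q<hi′ = trans (keeps i′ (subst (λ z → _ < toℕ z) (sym fi′≡hi′) q<hi′)) fi′≡hi′
    where
    fi′≡hi′ : f ⟨$⟩ʳ i′ ≡ h ⟨$⟩ʳ i′
    fi′≡hi′ = placed i′ q<hi′
  ... | inj₂ q≡hi′ = subst (λ x → f′ ⟨$⟩ʳ x ≡ h ⟨$⟩ʳ x) i≡i′ f′i≡hi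
    where
    i≡i′ : i ≡ i′
    i≡i′ = perm-injective h (toℕ-injective q≡hi′)

  place-at : ∀ q i k f → toℕ (h ⟨$⟩ʳ i) ≡ q → q < 2 ^ k → PlacedFrom (suc q) f → Reaches q k f
  place-at _ i k f refl q<2ᵏ placed =
    let len , len≤k , path = monotone-path n (f ⟨$⟩ʳ i) (h ⟨$⟩ʳ i) k q<2ᵏ fi≤q
        f′ , f′i≡hi , keeps , walk = carry path fi≤q f i refl
    in f′ , placed-step {f} {f′} i f′i≡hi placed keeps , len , len≤k , walk
    where
    fi≤q : toℕ (f ⟨$⟩ʳ i) ≤ toℕ (h ⟨$⟩ʳ i)
    fi≤q = s≤s⁻¹ (placed-small {f = f} placed i ≤-refl)

  place-value : ∀ q k f → q < 2 ^ n → q < 2 ^ k → PlacedFrom (suc q) f → Reaches q k f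
  place-value q k f q<2ⁿ = place-at q (h ⟨$⟩ˡ fromℕ< q<2ⁿ) k f hi≡q
    where
    hi≡q : toℕ (h ⟨$⟩ʳ (h ⟨$⟩ˡ fromℕ< q<2ⁿ)) ≡ q
    hi≡q = trans (cong toℕ (inverseʳ h)) (toℕ-fromℕ< q<2ⁿ)

  place-block : ∀ k r f → r ≤ 2 ^ k → 2 ^ k + r ≤ 2 ^ n →
                PlacedFrom (2 ^ k + r) f → Reaches (2 ^ k) (r * suc k) f
  place-block k zero f _ _ placed =
    reaches-here (subst (λ t → PlacedFrom t f) (+-identityʳ (2 ^ k)) placed)
  place-block k (suc r) f r<2ᵏ bound placed =
    reaches-then (place-value (2 ^ k + r) (suc k) f q<2ⁿ q<2ᵏ⁺¹
                              (subst (λ t → PlacedFrom t f) (+-suc (2 ^ k) r) placed))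
                 (λ f′ placed′ → place-block k r f′ (<⇒≤ r<2ᵏ)
                                   (≤-trans (+-monoʳ-≤ (2 ^ k) (n≤1+n r)) bound) placed′)
    where
    q<2ⁿ : 2 ^ k + r < 2 ^ n
    q<2ⁿ = subst (_≤ 2 ^ n) (+-suc (2 ^ k) r) bound
    q<2ᵏ⁺¹ : 2 ^ k + r < 2 ^ suc k
    q<2ᵏ⁺¹ = +-monoʳ-< (2 ^ k) (subst (r <_) (sym (+-identityʳ (2 ^ k))) r<2ᵏ)

  place-below : ∀ m f → 2 ^ m ≤ 2 ^ n → PlacedFrom (2 ^ m) f → Reaches 0 (cost m) f
  place-below zero f _ placed = place-value 0 0 f (m^n>0 2 n) (s≤s z≤n) placed
  place-below (suc m) f bound placed =
    reaches-then (place-block m (2 ^ m) f ≤-refl (subst (_≤ 2 ^ n) doubling bound)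
                              (subst (λ t → PlacedFrom t f) doubling placed))
                 (λ f′ placed′ → place-below m f′ (≤-trans (^-monoʳ-≤ 2 (n≤1+n m)) bound)
                                               placed′)
    where
    doubling : 2 ^ suc m ≡ 2 ^ m + 2 ^ m
    doubling = cong (2 ^ m +_) (+-identityʳ (2 ^ m))

  sort : ∀ g → DistAtMost n g h (cost n)
  sort g =
    let _ , placed₀ , k , k≤cost , walk = place-below n g ≤-refl nothing-above
    in k , k≤cost , walk-≈ʳ walk (λ i → placed₀ i z≤n)
    where
    nothing-above : PlacedFrom (2 ^ n) g
    nothing-above i 2ⁿ≤hi = ⊥-elim (<⇒≱ (toℕ<n (h ⟨$⟩ʳ i)) 2ⁿ≤hi)

mainTheorem8 : ∀ (n : ℕ) → n ≥ 1 → DiameterAtMost n ((n ∸ 1) * 2 ^ n + 1)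
mainTheorem8 (suc m) _ g h =
  subst (DistAtMost (suc m) g h) (cost-closed m) (Placement.sort (suc m) h g)
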